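{- Let $n\in\mathbb{N}$ be odd. Then $\mathsf{g}(C_2\oplus C_{2n})\ge 2n+3$.
   Context: For a finite abelian group $G$ (written additively), $\exp(G)$ denotes its exponent and $C_m$ a cyclic group of order $m$. The Harborth constant $\mathsf{g}(G)$ is the smallest $\ell\in\mathbb{N}$ such that every subset $S\subseteq G$ with $|S|\ge\ell$ contains a subset of exactly $\exp(G)$ elements whose sum is $0$. (If no subset of $G$ has cardinality $\ell$, the condition is vacuously satisfied.) -}

module Defs where

open import Data.Nat using (ℕ; zero; suc; _+_; _*_; _<_; _≥_; NonZero; _%_)
open import Data.Nat.DivMod using (m%n<n)
open import Data.Fin using (Fin; toℕ; fromℕ<)
open import Data.Product using (_×_; _,_; Σ; ∃-syntax)
open import Data.List using (List; length; foldr)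
open import Data.List.Relation.Unary.Unique.Propositional using (Unique)
open import Data.List.Relation.Binary.Sublist.Propositional using (_⊆_)
open import Relation.Binary.PropositionalEquality using (_≡_)
open import Relation.Nullary using (¬_)

addMod : (m : ℕ) → .{{_ : NonZero m}} → Fin m → Fin m → Fin m
addMod m a b = fromℕ< (m%n<n (toℕ a + toℕ b) m)

zeroMod : (m : ℕ) → .{{_ : NonZero m}} → Fin m
zeroMod m = fromℕ< (m%n<n 0 m)

C₂⊕C : (m : ℕ) → Set
C₂⊕C m = Fin 2 × Fin m

add : (m : ℕ) → .{{_ : NonZero m}} → C₂⊕C m → C₂⊕C m → C₂⊕C m
add m (a , b) (c , d) = addMod 2 a c , addMod m b d

zero⊕ : (m : ℕ) → .{{_ : NonZero m}} → C₂⊕C m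
zero⊕ m = zeroMod 2 , zeroMod m

sumG : (m : ℕ) → .{{_ : NonZero m}} → List (C₂⊕C m) → C₂⊕C m
sumG m = foldr (add m) (zero⊕ m)

-- A finite subset of G is a duplicate-free list; its subsets are its sublists.
-- HarborthProp m e ℓ : every subset S of C₂ ⊕ C_m with |S| ≥ ℓ has a subset T
-- with |T| = e (e = exp(G)) and σ(T) = 0.
HarborthProp : (m : ℕ) → .{{_ : NonZero m}} → (e ℓ : ℕ) → Set
HarborthProp m e ℓ =
  (S : List (C₂⊕C m)) → Unique S → length S ≥ ℓ →
  ∃[ T ] (T ⊆ S × length T ≡ e × sumG m T ≡ zero⊕ m)

IsHarborthConstant : (m : ℕ) → .{{_ : NonZero m}} → (e g : ℕ) → Set
IsHarborthConstant m e g = HarborthProp m e g × (∀ ℓ → ℓ < g → ¬ HarborthProp m e ℓ)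

-- Let n be odd and S = C₂ × {0, …, n} ⊆ C₂ ⊕ C₂ₙ, so |S| = 2n + 2. Because n + 1 is
-- even, σ(S) = (n + 1, n(n + 1)) = 0. Hence a zero-sum subset of size 2n would leave a
-- zero-sum complement {x, y} of two distinct elements. Parity forces x and y to share
-- their C₂-coordinate, and their C₂ₙ-coordinates i, j ≤ n satisfy 2n ∣ i + j, so
-- i + j ∈ {0, 2n} and i = j: a contradiction. So S witnesses 𝗀(C₂ ⊕ C₂ₙ) > 2n + 2.
module Submission where

open import Defs
open import Data.Nat using (ℕ; zero; suc; _+_; _*_; _≤_; _<_; s≤s; z≤n; NonZero; >-nonZero⁻¹; _%_)
open import Data.Nat.Properties
open import Data.Nat.DivMod using (m%n<n; m<n⇒m%n≡m; %-distribˡ-+; m%n%n≡m%n)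
open import Data.Nat.Divisibility using (_∣_; divides; ∣m+n∣m⇒∣n; ∣⇒≤; m%n≡0⇒n∣m)
open import Data.Nat.ListAction using (sum)
open import Data.Nat.ListAction.Properties using (sum-++; sum-↭)
open import Data.Nat.Tactic.RingSolver using (solve-∀)
open import Data.Fin using (Fin; toℕ; fromℕ<) renaming (zero to fz; suc to fs)
open import Data.Fin.Properties using (toℕ-fromℕ<; toℕ-injective)
open import Data.Product using (_×_; _,_; ∃-syntax; proj₁; proj₂)
open import Data.List using (List; []; _∷_; _++_; length; map)
open import Data.List.Properties using (map-++; length-++)
open import Data.List.Relation.Unary.All as All using (All; []; _∷_)
open import Data.List.Relation.Unary.AllPairs using (AllPairs; []; _∷_)
open import Data.List.Relation.Unary.Unique.Propositional using (Unique)
open import Data.List.Relation.Binary.Sublist.Propositional using (_⊆_; []; _∷_; _∷ʳ_)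
open import Data.List.Relation.Binary.Sublist.Propositional.Properties using (All-resp-⊆)
open import Data.List.Relation.Binary.Permutation.Propositional using (_↭_; ↭-refl; ↭-prep; ↭-trans)
open import Data.List.Relation.Binary.Permutation.Propositional.Properties using (shift; map⁺; ↭-length)
open import Function using (_∘_)
open import Relation.Binary.PropositionalEquality
open import Relation.Nullary using (¬_)

⊆-complement : {A : Set} {T S : List A} → T ⊆ S → ∃[ D ] (D ⊆ S × T ++ D ↭ S)
⊆-complement [] = [] , [] , ↭-refl
⊆-complement {T = T} (y ∷ʳ T⊆S) with ⊆-complement T⊆S
... | D , D⊆S , T++D↭S = y ∷ D , refl ∷ D⊆S , ↭-trans (shift y T D) (↭-prep y T++D↭S)
⊆-complement (refl ∷ T⊆S) with ⊆-complement T⊆S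
... | D , D⊆S , T++D↭S = D , _ ∷ʳ D⊆S , ↭-prep _ T++D↭S

AllPairs-resp-⊆ : {A : Set} {R : A → A → Set} {xs ys : List A} → xs ⊆ ys → AllPairs R ys → AllPairs R xs
AllPairs-resp-⊆ [] [] = []
AllPairs-resp-⊆ (y ∷ʳ xs⊆ys) (_ ∷ pairs) = AllPairs-resp-⊆ xs⊆ys pairs
AllPairs-resp-⊆ (refl ∷ xs⊆ys) (x∼ys ∷ pairs) = All-resp-⊆ xs⊆ys x∼ys ∷ AllPairs-resp-⊆ xs⊆ys pairs

sum-map-↭ : {A : Set} (f : A → ℕ) {T D S : List A} → T ++ D ↭ S →
  sum (map f T) + sum (map f D) ≡ sum (map f S)
sum-map-↭ f {T} {D} {S} T++D↭S = begin
  sum (map f T) + sum (map f D) ≡⟨ sum-++ (map f T) (map f D) ⟨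
  sum (map f T ++ map f D)      ≡⟨ cong sum (map-++ f T D) ⟨
  sum (map f (T ++ D))          ≡⟨ sum-↭ (map⁺ f T++D↭S) ⟩
  sum (map f S)                 ∎
  where open ≡-Reasoning

∣-sum-complement : {A : Set} (f : A → ℕ) {d : ℕ} (T : List A) {D S : List A} → T ++ D ↭ S →
  d ∣ sum (map f S) → d ∣ sum (map f T) → d ∣ sum (map f D)
∣-sum-complement f T T++D↭S d∣S d∣T =
  ∣m+n∣m⇒∣n (subst (_ ∣_) (sym (sum-map-↭ f {T} T++D↭S)) d∣S) d∣T

toℕ-addMod : ∀ p .{{_ : NonZero p}} (a b : Fin p) {s : ℕ} → toℕ b ≡ s % p →
  toℕ (addMod p a b) ≡ (toℕ a + s) % p
toℕ-addMod p a b {s} b≡s%p = begin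
  toℕ (addMod p a b)            ≡⟨ toℕ-fromℕ< (m%n<n (toℕ a + toℕ b) p) ⟩
  (toℕ a + toℕ b) % p           ≡⟨ cong (λ r → (toℕ a + r) % p) b≡s%p ⟩
  (toℕ a + s % p) % p           ≡⟨ %-distribˡ-+ (toℕ a) (s % p) p ⟩
  (toℕ a % p + s % p % p) % p   ≡⟨ cong (λ r → (toℕ a % p + r) % p) (m%n%n≡m%n s p) ⟩
  (toℕ a % p + s % p) % p       ≡⟨ %-distribˡ-+ (toℕ a) s p ⟨
  (toℕ a + s) % p               ∎
  where open ≡-Reasoning

0%≡0 : ∀ p .{{_ : NonZero p}} → 0 % p ≡ 0
0%≡0 p = m<n⇒m%n≡m (>-nonZero⁻¹ p)

Fin2-even⇒≡ : (a b : Fin 2) → 2 ∣ toℕ a + toℕ b → a ≡ b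
Fin2-even⇒≡ fz fz _ = refl
Fin2-even⇒≡ (fs fz) (fs fz) _ = refl
Fin2-even⇒≡ fz (fs fz) 2∣1 with s≤s () ← ∣⇒≤ 2∣1
Fin2-even⇒≡ (fs fz) fz 2∣1 with s≤s () ← ∣⇒≤ 2∣1

+-maximal⇒≡ : ∀ {n i j} → i ≤ n → j ≤ n → 2 * n ≤ i + j → i ≡ j
+-maximal⇒≡ {n} {i} {j} i≤n j≤n 2n≤i+j = trans (≤-antisym i≤n n≤i) (≤-antisym n≤j j≤n)
  where
  n+n≤i+j : n + n ≤ i + j
  n+n≤i+j = subst (_≤ i + j) (cong (n +_) (+-identityʳ n)) 2n≤i+j
  n≤i : n ≤ i
  n≤i = +-cancelʳ-≤ n n i (≤-trans n+n≤i+j (+-monoʳ-≤ i j≤n))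
  n≤j : n ≤ j
  n≤j = +-cancelˡ-≤ n n j (≤-trans n+n≤i+j (+-monoˡ-≤ j i≤n))

∣+-bounded⇒≡ : ∀ {n i j} → i ≤ n → j ≤ n → 2 * n ∣ i + j → i ≡ j
∣+-bounded⇒≡ {i = zero} {zero} _ _ _ = refl
∣+-bounded⇒≡ {i = suc _} i≤n j≤n 2n∣i+j = +-maximal⇒≡ i≤n j≤n (∣⇒≤ 2n∣i+j)
∣+-bounded⇒≡ {i = zero} {suc _} i≤n j≤n 2n∣i+j = +-maximal⇒≡ i≤n j≤n (∣⇒≤ 2n∣i+j)

module _ {m : ℕ} where

  sum₁ sum₂ : List (C₂⊕C m) → ℕ
  sum₁ = sum ∘ map (toℕ ∘ proj₁)
  sum₂ = sum ∘ map (toℕ ∘ proj₂)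

  module _ .{{_ : NonZero m}} where

    toℕ-proj₁-sumG : ∀ T → toℕ (proj₁ (sumG m T)) ≡ sum₁ T % 2
    toℕ-proj₁-sumG [] = refl
    toℕ-proj₁-sumG (x ∷ T) = toℕ-addMod 2 (proj₁ x) _ (toℕ-proj₁-sumG T)

    toℕ-proj₂-sumG : ∀ T → toℕ (proj₂ (sumG m T)) ≡ sum₂ T % m
    toℕ-proj₂-sumG [] = toℕ-fromℕ< (m%n<n 0 m)
    toℕ-proj₂-sumG (x ∷ T) = toℕ-addMod m (proj₂ x) _ (toℕ-proj₂-sumG T)

    zeroSum⇒2∣sum₁ : ∀ T → sumG m T ≡ zero⊕ m → 2 ∣ sum₁ T
    zeroSum⇒2∣sum₁ T σT≡0 = m%n≡0⇒n∣m (sum₁ T) 2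
      (trans (sym (toℕ-proj₁-sumG T)) (cong (toℕ ∘ proj₁) σT≡0))

    zeroSum⇒m∣sum₂ : ∀ T → sumG m T ≡ zero⊕ m → m ∣ sum₂ T
    zeroSum⇒m∣sum₂ T σT≡0 = m%n≡0⇒n∣m (sum₂ T) m (begin
      sum₂ T % m                   ≡⟨ toℕ-proj₂-sumG T ⟨
      toℕ (proj₂ (sumG m T))       ≡⟨ cong (toℕ ∘ proj₂) σT≡0 ⟩
      toℕ (proj₂ (sumG m []))      ≡⟨ toℕ-proj₂-sumG [] ⟩
      0 % m                        ≡⟨ 0%≡0 m ⟩
      0                            ∎)
      where open ≡-Reasoning

    residue : ℕ → Fin m
    residue c = fromℕ< (m%n<n c m)

    toℕ-residue : ∀ {c} → c < m → toℕ (residue c) ≡ c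
    toℕ-residue {c} c<m = trans (toℕ-fromℕ< (m%n<n c m)) (m<n⇒m%n≡m c<m)

    rectangle : ℕ → List (C₂⊕C m)
    rectangle zero = []
    rectangle (suc c) = (fz , residue c) ∷ (fs fz , residue c) ∷ rectangle c

    length-rectangle : ∀ c → length (rectangle c) ≡ 2 * c
    length-rectangle zero = refl
    length-rectangle (suc c) = trans (cong (suc ∘ suc) (length-rectangle c)) (lemma c)
      where
      lemma : ∀ c → suc (suc (2 * c)) ≡ 2 * suc c
      lemma = solve-∀

    sum₁-rectangle : ∀ c → sum₁ (rectangle c) ≡ c
    sum₁-rectangle zero = refl
    sum₁-rectangle (suc c) = cong suc (sum₁-rectangle c)

    sum₂-rectangle : ∀ c → suc c ≤ m → sum₂ (rectangle (suc c)) ≡ suc c * c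
    sum₂-rectangle zero _ = cong (λ r → r + (r + 0)) (toℕ-residue {0} (>-nonZero⁻¹ m))
    sum₂-rectangle (suc c) 2+c≤m = begin
      toℕ (residue (suc c)) + (toℕ (residue (suc c)) + sum₂ (rectangle (suc c)))
        ≡⟨ cong (λ s → toℕ (residue (suc c)) + (toℕ (residue (suc c)) + s)) (sum₂-rectangle c (<⇒≤ 2+c≤m)) ⟩
      toℕ (residue (suc c)) + (toℕ (residue (suc c)) + suc c * c)
        ≡⟨ cong (λ r → r + (r + suc c * c)) (toℕ-residue 2+c≤m) ⟩
      suc c + (suc c + suc c * c)
        ≡⟨ lemma c ⟩
      suc (suc c) * suc c ∎
      where
      open ≡-Reasoning
      lemma : ∀ c → suc c + (suc c + suc c * c) ≡ suc (suc c) * suc c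
      lemma = solve-∀

    rectangle-bounded : ∀ c → c ≤ m → All (λ x → toℕ (proj₂ x) < c) (rectangle c)
    rectangle-bounded zero _ = []
    rectangle-bounded (suc c) c<m = c< ∷ c< ∷ All.map m≤n⇒m≤1+n (rectangle-bounded c (<⇒≤ c<m))
      where
      c< : toℕ (residue c) < suc c
      c< = ≤-reflexive (cong suc (toℕ-residue c<m))

    rectangle-unique : ∀ c → c ≤ m → Unique (rectangle c)
    rectangle-unique zero _ = []
    rectangle-unique (suc c) c<m =
      ((λ ()) ∷ All.map fresh below) ∷ All.map fresh below ∷ rectangle-unique c (<⇒≤ c<m)
      where
      below : All (λ x → toℕ (proj₂ x) < c) (rectangle c)
      below = rectangle-bounded c (<⇒≤ c<m)
      fresh : ∀ {a} {y : C₂⊕C m} → toℕ (proj₂ y) < c → (a , residue c) ≢ y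
      fresh y<c refl = <-irrefl (toℕ-residue c<m) y<c

pair-zeroSum⇒≡ : ∀ {n} (x y : C₂⊕C (2 * n)) → toℕ (proj₂ x) ≤ n → toℕ (proj₂ y) ≤ n →
  2 ∣ sum₁ (x ∷ y ∷ []) → 2 * n ∣ sum₂ (x ∷ y ∷ []) → x ≡ y
pair-zeroSum⇒≡ {n} (a , i) (b , j) i≤n j≤n 2∣a+b 2n∣i+j = cong₂ _,_
  (Fin2-even⇒≡ a b (subst (2 ∣_) (cong (toℕ a +_) (+-identityʳ (toℕ b))) 2∣a+b))
  (toℕ-injective (∣+-bounded⇒≡ i≤n j≤n (subst (2 * n ∣_) (cong (toℕ i +_) (+-identityʳ (toℕ j))) 2n∣i+j)))

HarborthProp-mono : ∀ {m} .{{_ : NonZero m}} {e ℓ ℓ′} → ℓ ≤ ℓ′ → HarborthProp m e ℓ → HarborthProp m e ℓ′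
HarborthProp-mono ℓ≤ℓ′ harborth S S-unique ℓ′≤|S| = harborth S S-unique (≤-trans ℓ≤ℓ′ ℓ′≤|S|)

HarborthProp-lowerBound : ∀ {m} .{{_ : NonZero m}} {e g ℓ} →
  HarborthProp m e g → ¬ HarborthProp m e ℓ → ℓ < g
HarborthProp-lowerBound harborth ¬harborth = ≰⇒> (λ g≤ℓ → ¬harborth (HarborthProp-mono g≤ℓ harborth))

module OddCase (k : ℕ) where
  n m : ℕ
  n = suc (2 * k)
  m = 2 * n

  S : List (C₂⊕C m)
  S = rectangle (suc n)

  1+n≤m : suc n ≤ m
  1+n≤m = subst (_≤ m) (+-comm n 1) (+-monoʳ-≤ n (s≤s z≤n))

  length-S : length S ≡ m + 2
  length-S = trans (length-rectangle (suc n)) (lemma n)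
    where
    lemma : ∀ n → 2 * suc n ≡ 2 * n + 2
    lemma = solve-∀

  2∣sum₁-S : 2 ∣ sum₁ S
  2∣sum₁-S = divides (suc k) (trans (sum₁-rectangle (suc n)) (lemma k))
    where
    lemma : ∀ k → suc (suc (2 * k)) ≡ suc k * 2
    lemma = solve-∀

  m∣sum₂-S : m ∣ sum₂ S
  m∣sum₂-S = divides (suc k) (trans (sum₂-rectangle n 1+n≤m) (lemma k))
    where
    lemma : ∀ k → suc (suc (2 * k)) * suc (2 * k) ≡ suc k * (2 * suc (2 * k))
    lemma = solve-∀

  no-zeroSum-pair : ∀ D → length D ≡ 2 → D ⊆ S → 2 ∣ sum₁ D → m ∣ sum₂ D → ¬ Unique D
  no-zeroSum-pair (x ∷ y ∷ []) refl D⊆S 2∣ m∣ ((x≢y ∷ []) ∷ _)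
    with x≤n ∷ y≤n ∷ [] ← All-resp-⊆ D⊆S (rectangle-bounded (suc n) 1+n≤m) =
    x≢y (pair-zeroSum⇒≡ x y (≤-pred x≤n) (≤-pred y≤n) 2∣ m∣)

  S-unique : Unique S
  S-unique = rectangle-unique (suc n) 1+n≤m

  S-has-no-zeroSum-subset : ∀ T → T ⊆ S → length T ≡ m → sumG m T ≢ zero⊕ m
  S-has-no-zeroSum-subset T T⊆S |T|≡m σT≡0 with D , D⊆S , T++D↭S ← ⊆-complement T⊆S =
    no-zeroSum-pair D |D|≡2 D⊆S
      (∣-sum-complement (toℕ ∘ proj₁) T T++D↭S 2∣sum₁-S (zeroSum⇒2∣sum₁ T σT≡0))
      (∣-sum-complement (toℕ ∘ proj₂) T T++D↭S m∣sum₂-S (zeroSum⇒m∣sum₂ T σT≡0))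
      (AllPairs-resp-⊆ D⊆S S-unique)
    where
    |D|≡2 : length D ≡ 2
    |D|≡2 = +-cancelˡ-≡ m (length D) 2 (begin
      m + length D          ≡⟨ cong (_+ length D) |T|≡m ⟨
      length T + length D   ≡⟨ length-++ T ⟨
      length (T ++ D)       ≡⟨ ↭-length T++D↭S ⟩
      length S              ≡⟨ length-S ⟩
      m + 2                 ∎)
      where open ≡-Reasoning

  ¬HarborthProp : ¬ HarborthProp m m (m + 2)
  ¬HarborthProp harborth with T , T⊆S , |T|≡m , σT≡0 ← harborth S S-unique (≤-reflexive (sym length-S)) =
    S-has-no-zeroSum-subset T T⊆S |T|≡m σT≡0

lemma5p2 : (k : ℕ) → let n = suc (2 * k) in (g : ℕ) →
    IsHarborthConstant (2 * n) (2 * n) g → 2 * n + 3 ≤ g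
lemma5p2 k g (harborth , _) =
  subst (_≤ g) (sym (+-suc (2 * n) 2)) (HarborthProp-lowerBound harborth ¬HarborthProp)
  where open OddCase k
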